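{- Let $k\ge3$ and let $n_1,n_2$ be positive integers with $\gcd(n_1,n_2)=1$. Suppose $[a_0,\dots,a_{k-1}]$ and $[b_0,\dots,b_{k-1}]$ are $k$-gons modulo $n_1$ and $n_2$ respectively, with monodromy groups $N_1\rtimes C_k$ and $N_2\rtimes C_k$. Then there exists a $k$-gon $[c_0,\dots,c_{k-1}]$ modulo $n_1n_2$ with monodromy group $(N_1\times N_2)\rtimes C_k$.
   Context: A $k$-tuple of positive integers $[a_0,\dots,a_{k-1}]$ ($k\ge3$) is a (geometric) $k$-gon modulo $n$ if $\sum a_i=(k-2)n$, $a_i<2n$, $a_i\ne n$ for all $i$, and $\gcd(a_0,\dots,a_{k-1},n)=1$. Its monodromy group is $N\rtimes C_k$, where $N\subseteq(\mathbb{Z}/n\mathbb{Z})^k$ is the additive subgroup generated by the columns of the circulant matrix with $(i,j)$ entry $a_{(i-j)\bmod k}$, and $C_k$ acts on $N$ by cyclic permutation of coordinates (equivalently, the monodromy group of the dessin on the polygon's billiards surface). Writing the monodromy group as $A\rtimes C_k$ for an abelian group $A$ means the subgroup $N$ is isomorphic to $A$. -}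

module Defs where

open import Data.Nat as ℕ using (ℕ; zero; suc; _≤_; _<_; _%_)
open import Data.Nat.DivMod using (m%n<n)
open import Data.Integer as ℤ using (ℤ; +_)
open import Data.Integer.Divisibility using () renaming (_∣_ to _∣ℤ_)
open import Data.Nat.Divisibility using (_∣_)
open import Data.Fin using (Fin; toℕ; fromℕ<)
open import Data.List using (List; map; allFin; foldr)
open import Data.Product using (Σ; ∃; _×_; _,_; proj₁)
open import Relation.Binary.PropositionalEquality using (_≡_; _≢_)

sumℕ : ∀ {k} → (Fin k → ℕ) → ℕ
sumℕ {k} f = foldr ℕ._+_ 0 (map f (allFin k))

sumℤ : ∀ {k} → (Fin k → ℤ) → ℤ
sumℤ {k} f = foldr ℤ._+_ (+ 0) (map f (allFin k))

-- A k-gon modulo n (k ≥ 3 is a separate hypothesis in the theorem)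
record IsKGon (k n : ℕ) (a : Fin k → ℕ) : Set where
  field
    positive  : ∀ i → 0 < a i
    angleSum  : sumℕ a ≡ (k ℕ.∸ 2) ℕ.* n
    below2n   : ∀ i → a i < 2 ℕ.* n
    notN      : ∀ i → a i ≢ n
    coprime   : ∀ d → d ∣ n → (∀ i → d ∣ a i) → d ≡ 1

-- (i - j) mod k as an element of Fin k
idx : ∀ {k} → Fin k → Fin k → Fin k
idx {suc m} i j = fromℕ< (m%n<n (toℕ i ℕ.+ (suc m ℕ.∸ toℕ j)) (suc m))

-- Elements of (ℤ/nℤ)^k are represented by integer vectors, compared modulo n.
Vecℤ : ℕ → Set
Vecℤ k = Fin k → ℤ

_≈[_]_ : ∀ {k} → Vecℤ k → ℕ → Vecℤ k → Set
u ≈[ n ] v = ∀ i → (+ n) ∣ℤ (u i ℤ.- v i)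

_⊕_ : ∀ {k} → Vecℤ k → Vecℤ k → Vecℤ k
(u ⊕ v) i = u i ℤ.+ v i

-- The (i,j) entry of the circulant matrix is a_{(i-j) mod k}; column j.
column : ∀ {k} → (Fin k → ℕ) → Fin k → Vecℤ k
column a j i = + a (idx i j)

-- Membership in N = subgroup of (ℤ/nℤ)^k generated by the columns:
-- v is (mod n) an integer linear combination of the columns.
InN : (k n : ℕ) → (Fin k → ℕ) → Vecℤ k → Set
InN k n a v = Σ (Fin k → ℤ) λ x → (λ i → sumℤ (λ j → x j ℤ.* column a j i)) ≈[ n ] v

Elt : (k n : ℕ) → (Fin k → ℕ) → Set
Elt k n a = Σ (Vecℤ k) (InN k n a)

-- A group isomorphism N ≅ N₁ × N₂ (all groups written additively,
-- equality of elements is congruence mod the respective modulus).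
record IsoToProduct (k n : ℕ) (c : Fin k → ℕ)
                    (n₁ : ℕ) (a : Fin k → ℕ) (n₂ : ℕ) (b : Fin k → ℕ) : Set where
  field
    to₁ : Elt k n c → Elt k n₁ a
    to₂ : Elt k n c → Elt k n₂ b
    cong-to : ∀ u v → proj₁ u ≈[ n ] proj₁ v →
              (proj₁ (to₁ u) ≈[ n₁ ] proj₁ (to₁ v)) × (proj₁ (to₂ u) ≈[ n₂ ] proj₁ (to₂ v))
    hom₁ : ∀ u v (w : InN k n c (proj₁ u ⊕ proj₁ v)) →
           proj₁ (to₁ (proj₁ u ⊕ proj₁ v , w)) ≈[ n₁ ] (proj₁ (to₁ u) ⊕ proj₁ (to₁ v))
    hom₂ : ∀ u v (w : InN k n c (proj₁ u ⊕ proj₁ v)) →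
           proj₁ (to₂ (proj₁ u ⊕ proj₁ v , w)) ≈[ n₂ ] (proj₁ (to₂ u) ⊕ proj₁ (to₂ v))
    injective : ∀ u v → proj₁ (to₁ u) ≈[ n₁ ] proj₁ (to₁ v) →
                proj₁ (to₂ u) ≈[ n₂ ] proj₁ (to₂ v) → proj₁ u ≈[ n ] proj₁ v
    surjective : ∀ (p : Elt k n₁ a) (q : Elt k n₂ b) → Σ (Elt k n c) λ u →
                 (proj₁ (to₁ u) ≈[ n₁ ] proj₁ p) × (proj₁ (to₂ u) ≈[ n₂ ] proj₁ q)

-- Put d_i = a_i n₂ + b_i n₁ and N = n₁ n₂.  Modulo n₁ the vector d is the unit n₂ times a, and modulo n₂
-- it is the unit n₁ times b.  Scaling the first column of a circulant matrix by a unit does not change the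
-- span of its columns, so reduction modulo n₁ and modulo n₂ (both the identity on integer vectors) maps the
-- group of d, and of any c ≡ ±d (mod N), onto N₁ and N₂; by the Chinese remainder theorem the pair of
-- reductions is an isomorphism onto N₁ × N₂.  The same unit relations carry positivity, c_i ≠ N and the
-- gcd condition over from a and b.
--
-- It remains to pick such a c that is a k-gon modulo N.  The residues r_i = d_i mod N lie strictly between
-- 0 and N and sum to mN for some m.  If m ≤ k − 2, adding N to k − 2 − m of them reaches the angle sum
-- (k − 2)N; otherwise m ≥ 2 and the same works for the complements N − r_i ≡ −d_i, which sum to (k − m)N.
module Submission where

open import Defs
open import Data.Fin as Fin using (Fin)
open import Data.Integer as ℤ using (ℤ; +_; -_; _+_; _-_; _*_; _⊖_)
open import Data.Integer.Divisibility using () renaming (_∣_ to _∣ℤ_)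
open import Data.Integer.Divisibility.Signed as Signed using (∣ᵤ⇒∣; ∣⇒∣ᵤ)
import Data.Integer.Properties as ℤ
open import Data.Integer.Tactic.RingSolver using (solve-∀)
open import Data.List using (map; allFin; foldr)
import Data.List.Properties as List
open import Data.Nat as ℕ using (ℕ; zero; suc; _∸_; _≤_; _<_)
open import Data.Nat.Coprimality as Coprimality using (Coprime)
open import Data.Nat.DivMod using (_%_; _/_; m≡m%n+[m/n]*n; m%n<n)
open import Data.Nat.Divisibility as ℕ∣ using (divides)
open import Data.Nat.GCD using (gcd; gcd[m,n]∣m; gcd[m,n]∣n; module Bézout)
open import Data.Nat.LCM using (lcm; lcm-least; gcd*lcm)
import Data.Nat.Properties as ℕ
open import Algebra.Properties.CommutativeSemigroup ℕ.+-commutativeSemigroup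
  using () renaming (interchange to +-interchange)
open import Data.Product using (Σ; ∃; _×_; _,_; proj₁; proj₂)
open import Data.Vec.Functional using (head; tail)
open import Function using (_∘_; id)
open import Relation.Binary.Bundles using (Setoid)
open import Relation.Binary.PropositionalEquality
import Relation.Binary.Reasoning.Setoid
open import Relation.Nullary using (¬_; yes; no)

-- A record rather than a synonym for divisibility of x - y, so that x and y are recovered by unification.
infix 4 _≡_mod_
record _≡_mod_ (x y : ℤ) (n : ℕ) : Set where
  constructor ≡mod
  field
    divides-difference : + n Signed.∣ x - y

open _≡_mod_

module _ {n : ℕ} where

  ≡mod-by-quotient : ∀ {x y} q → x - y ≡ q * + n → x ≡ y mod n
  ≡mod-by-quotient q eq = ≡mod (Signed.divides q eq)

  ≡mod-reflexive : ∀ {x y} → x ≡ y → x ≡ y mod n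
  ≡mod-reflexive {x} refl = ≡mod-by-quotient (+ 0) (ℤ.+-inverseʳ x)

  ≡mod-refl : ∀ {x} → x ≡ x mod n
  ≡mod-refl = ≡mod-reflexive refl

  ≡mod-sym : ∀ {x y} → x ≡ y mod n → y ≡ x mod n
  ≡mod-sym {x} {y} (≡mod n∣x-y) = ≡mod (subst (+ n Signed.∣_) (negate x y) (Signed.∣m⇒∣-m n∣x-y))
    where
    negate : ∀ x y → - (x - y) ≡ y - x
    negate = solve-∀

  ≡mod-trans : ∀ {x y z} → x ≡ y mod n → y ≡ z mod n → x ≡ z mod n
  ≡mod-trans {x} {y} {z} (≡mod p) (≡mod q) =
    ≡mod (subst (+ n Signed.∣_) (split x y z) (Signed.∣m∣n⇒∣m+n p q))
    where
    split : ∀ x y z → (x - y) + (y - z) ≡ x - z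
    split = solve-∀

  +-cong-mod : ∀ {x x′ y y′} → x ≡ x′ mod n → y ≡ y′ mod n → x + y ≡ x′ + y′ mod n
  +-cong-mod {x} {x′} {y} {y′} (≡mod p) (≡mod q) =
    ≡mod (subst (+ n Signed.∣_) (regroup x x′ y y′) (Signed.∣m∣n⇒∣m+n p q))
    where
    regroup : ∀ x x′ y y′ → (x - x′) + (y - y′) ≡ (x + y) - (x′ + y′)
    regroup = solve-∀

  *-congˡ-mod : ∀ z {x y} → x ≡ y mod n → z * x ≡ z * y mod n
  *-congˡ-mod z {x} {y} (≡mod p) = ≡mod (subst (+ n Signed.∣_) (distrib z x y) (Signed.∣n⇒∣m*n z p))
    where
    distrib : ∀ z x y → z * (x - y) ≡ z * x - z * y
    distrib = solve-∀

  *-congʳ-mod : ∀ z {x y} → x ≡ y mod n → x * z ≡ y * z mod n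
  *-congʳ-mod z {x} {y} p = subst₂ (_≡_mod n) (ℤ.*-comm z x) (ℤ.*-comm z y) (*-congˡ-mod z p)

  multiple≡0-mod : ∀ q → q * + n ≡ + 0 mod n
  multiple≡0-mod q = ≡mod-by-quotient q (ℤ.+-identityʳ (q * + n))

≡mod-setoid : ℕ → Setoid _ _
≡mod-setoid n = record
  { Carrier = ℤ
  ; _≈_ = _≡_mod n
  ; isEquivalence = record { refl = ≡mod-refl ; sym = ≡mod-sym ; trans = ≡mod-trans }
  }

module ≡mod-Reasoning (n : ℕ) = Relation.Binary.Reasoning.Setoid (≡mod-setoid n)

+-multiple-mod : ∀ {n} x q → x + q * + n ≡ x mod n
+-multiple-mod {n} x q = begin
  x + q * + n   ≈⟨ +-cong-mod (≡mod-refl {x = x}) (multiple≡0-mod q) ⟩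
  x + + 0       ≡⟨ ℤ.+-identityʳ x ⟩
  x             ∎
  where open ≡mod-Reasoning n

≡mod-weaken : ∀ {m n x y} → m ℕ∣.∣ n → x ≡ y mod n → x ≡ y mod m
≡mod-weaken m∣n (≡mod p) = ≡mod (Signed.∣-trans (∣ᵤ⇒∣ m∣n) p)

≡mod⇒∣ : ∀ {n x y} → x ≡ y mod n → + n ∣ℤ (x - y)
≡mod⇒∣ (≡mod p) = ∣⇒∣ᵤ p

∣⇒≡mod : ∀ {n x y} → + n ∣ℤ (x - y) → x ≡ y mod n
∣⇒≡mod p = ≡mod (∣ᵤ⇒∣ p)

≈-refl : ∀ {k n} (u : Vecℤ k) → u ≈[ n ] u
≈-refl u i = ≡mod⇒∣ (≡mod-refl {x = u i})

*∣-of-coprime : ∀ {m n x} → Coprime m n → m ℕ∣.∣ x → n ℕ∣.∣ x → m ℕ.* n ℕ∣.∣ x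
*∣-of-coprime {m} {n} coprime m∣x n∣x = subst (ℕ∣._∣ _) lcm≡* (lcm-least m∣x n∣x)
  where
  open ≡-Reasoning
  lcm≡* : lcm m n ≡ m ℕ.* n
  lcm≡* = begin
    lcm m n              ≡⟨ ℕ.*-identityˡ (lcm m n) ⟨
    1 ℕ.* lcm m n        ≡⟨ cong (ℕ._* lcm m n) (Coprimality.coprime⇒gcd≡1 coprime) ⟨
    gcd m n ℕ.* lcm m n  ≡⟨ gcd*lcm m n ⟩
    m ℕ.* n              ∎

≡mod-combine : ∀ {m n x y} → Coprime m n → x ≡ y mod m → x ≡ y mod n → x ≡ y mod m ℕ.* n
≡mod-combine coprime p q = ∣⇒≡mod (*∣-of-coprime coprime (≡mod⇒∣ p) (≡mod⇒∣ q))

≈-combine : ∀ {k m n} {u v : Vecℤ k} → Coprime m n → u ≈[ m ] v → u ≈[ n ] v → u ≈[ m ℕ.* n ] v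
≈-combine coprime u≈v₁ u≈v₂ i = *∣-of-coprime coprime (u≈v₁ i) (u≈v₂ i)

pos-+* : ∀ a b c → + (a ℕ.+ b ℕ.* c) ≡ + a + + b * + c
pos-+* a b c = trans (ℤ.pos-+ a (b ℕ.* c)) (cong (λ z → + a + z) (ℤ.pos-* b c))

pos-+*≡pos-* : ∀ a b c d e → a ℕ.+ b ℕ.* c ≡ d ℕ.* e → + a + + b * + c ≡ + d * + e
pos-+*≡pos-* a b c d e eq = trans (sym (pos-+* a b c)) (trans (cong +_ eq) (ℤ.pos-* d e))

coprime⇒invertible : ∀ {m n} → Coprime m n → ∃ λ σ → σ * + n ≡ + 1 mod m
coprime⇒invertible {m} {n} coprime with Coprimality.coprime-Bézout coprime
... | Bézout.+- x y eq = - + y , ≡mod-by-quotient (- + x) (begin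
  (- + y) * + n - + 1  ≡⟨ rearrange (+ y) (+ n) ⟩
  - (+ 1 + + y * + n)  ≡⟨ cong -_ (pos-+*≡pos-* 1 y n x m eq) ⟩
  - (+ x * + m)        ≡⟨ ℤ.neg-distribˡ-* (+ x) (+ m) ⟩
  (- + x) * + m        ∎)
  where
  open ≡-Reasoning
  rearrange : ∀ y n → (- y) * n - + 1 ≡ - (+ 1 + y * n)
  rearrange = solve-∀
... | Bézout.-+ x y eq = + y , ≡mod-by-quotient (+ x) (begin
  + y * + n - + 1          ≡⟨ cong (_- + 1) (pos-+*≡pos-* 1 x m y n eq) ⟨
  (+ 1 + + x * + m) - + 1  ≡⟨ cancel (+ x * + m) ⟩
  + x * + m                ∎)
  where
  open ≡-Reasoning
  cancel : ∀ z → (+ 1 + z) - + 1 ≡ z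
  cancel = solve-∀

crt-idempotent : ∀ {m n} → Coprime m n → ∃ λ e → e ≡ + 1 mod m × e ≡ + 0 mod n
crt-idempotent coprime with coprime⇒invertible coprime
... | σ , σn≡1 = σ * _ , σn≡1 , multiple≡0-mod σ

module _ {n : ℕ} where

  select₁ : ∀ {e f} x y → e ≡ + 1 mod n → f ≡ + 0 mod n → e * x + f * y ≡ x mod n
  select₁ {e} {f} x y e≡1 f≡0 = begin
    e * x + f * y      ≈⟨ +-cong-mod (*-congʳ-mod x e≡1) (*-congʳ-mod y f≡0) ⟩
    + 1 * x + + 0 * y  ≡⟨ simplify x y ⟩
    x                  ∎
    where
    open ≡mod-Reasoning n
    simplify : ∀ x y → + 1 * x + + 0 * y ≡ x
    simplify = solve-∀

  select₂ : ∀ {e f} x y → e ≡ + 0 mod n → f ≡ + 1 mod n → e * x + f * y ≡ y mod n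
  select₂ {e} {f} x y e≡0 f≡1 = subst (_≡ y mod n) (ℤ.+-comm (f * y) (e * x)) (select₁ y x f≡1 e≡0)

foldr-map-allFin-suc : ∀ {A : Set} (_∙_ : A → A → A) (ε : A) {k} (f : Fin (suc k) → A) →
  foldr _∙_ ε (map f (allFin (suc k))) ≡ head f ∙ foldr _∙_ ε (map (tail f) (allFin k))
foldr-map-allFin-suc _∙_ ε f = cong (λ xs → head f ∙ foldr _∙_ ε xs)
  (trans (List.map-tabulate Fin.suc f) (sym (List.map-tabulate id (tail f))))

sumℕ-suc : ∀ {k} (f : Fin (suc k) → ℕ) → sumℕ f ≡ head f ℕ.+ sumℕ (tail f)
sumℕ-suc = foldr-map-allFin-suc ℕ._+_ 0

sumℤ-suc : ∀ {k} (f : Fin (suc k) → ℤ) → sumℤ f ≡ head f + sumℤ (tail f)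
sumℤ-suc = foldr-map-allFin-suc _+_ (+ 0)

sumℤ-cong-mod : ∀ {n k} {f g : Fin k → ℤ} → (∀ i → f i ≡ g i mod n) → sumℤ f ≡ sumℤ g mod n
sumℤ-cong-mod {k = zero} _ = ≡mod-refl
sumℤ-cong-mod {n} {suc k} {f} {g} f≡g = begin
  sumℤ f                     ≡⟨ sumℤ-suc f ⟩
  head f + sumℤ (tail f)     ≈⟨ +-cong-mod (f≡g Fin.zero) (sumℤ-cong-mod (f≡g ∘ Fin.suc)) ⟩
  head g + sumℤ (tail g)     ≡⟨ sumℤ-suc g ⟨
  sumℤ g                     ∎
  where open ≡mod-Reasoning n

sumℕ-cong : ∀ {k} {f g : Fin k → ℕ} → (∀ i → f i ≡ g i) → sumℕ f ≡ sumℕ g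
sumℕ-cong {zero} _ = refl
sumℕ-cong {suc k} {f} {g} f≡g = begin
  sumℕ f                       ≡⟨ sumℕ-suc f ⟩
  head f ℕ.+ sumℕ (tail f)     ≡⟨ cong₂ ℕ._+_ (f≡g Fin.zero) (sumℕ-cong (f≡g ∘ Fin.suc)) ⟩
  head g ℕ.+ sumℕ (tail g)     ≡⟨ sumℕ-suc g ⟨
  sumℕ g                       ∎
  where open ≡-Reasoning

sumℕ-+ : ∀ {k} (f g : Fin k → ℕ) → sumℕ (λ i → f i ℕ.+ g i) ≡ sumℕ f ℕ.+ sumℕ g
sumℕ-+ {zero} f g = refl
sumℕ-+ {suc k} f g = begin
  sumℕ (λ i → f i ℕ.+ g i)
    ≡⟨ sumℕ-suc (λ i → f i ℕ.+ g i) ⟩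
  (head f ℕ.+ head g) ℕ.+ sumℕ (λ i → tail f i ℕ.+ tail g i)
    ≡⟨ cong ((head f ℕ.+ head g) ℕ.+_) (sumℕ-+ (tail f) (tail g)) ⟩
  (head f ℕ.+ head g) ℕ.+ (sumℕ (tail f) ℕ.+ sumℕ (tail g))
    ≡⟨ +-interchange (head f) (head g) (sumℕ (tail f)) (sumℕ (tail g)) ⟩
  (head f ℕ.+ sumℕ (tail f)) ℕ.+ (head g ℕ.+ sumℕ (tail g))
    ≡⟨ cong₂ ℕ._+_ (sumℕ-suc f) (sumℕ-suc g) ⟨
  sumℕ f ℕ.+ sumℕ g
    ∎
  where open ≡-Reasoning

sumℕ-*ʳ : ∀ {k} (f : Fin k → ℕ) m → sumℕ (λ i → f i ℕ.* m) ≡ sumℕ f ℕ.* m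
sumℕ-*ʳ {zero} f m = refl
sumℕ-*ʳ {suc k} f m = begin
  sumℕ (λ i → f i ℕ.* m)                          ≡⟨ sumℕ-suc (λ i → f i ℕ.* m) ⟩
  head f ℕ.* m ℕ.+ sumℕ (λ i → tail f i ℕ.* m)    ≡⟨ cong (head f ℕ.* m ℕ.+_) (sumℕ-*ʳ (tail f) m) ⟩
  head f ℕ.* m ℕ.+ sumℕ (tail f) ℕ.* m            ≡⟨ ℕ.*-distribʳ-+ m (head f) (sumℕ (tail f)) ⟨
  (head f ℕ.+ sumℕ (tail f)) ℕ.* m                ≡⟨ cong (ℕ._* m) (sumℕ-suc f) ⟨
  sumℕ f ℕ.* m                                    ∎
  where open ≡-Reasoning

sumℕ-const : ∀ k c → sumℕ {k} (λ _ → c) ≡ k ℕ.* c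
sumℕ-const zero c = refl
sumℕ-const (suc k) c = trans (sumℕ-suc {k} (λ _ → c)) (cong (c ℕ.+_) (sumℕ-const k c))

IsKGon-∤ : ∀ {k n a} → IsKGon k n a → ∀ i → ¬ n ℕ∣.∣ a i
IsKGon-∤ A i (divides zero eq) = ℕ.<-irrefl (sym eq) (IsKGon.positive A i)
IsKGon-∤ {n = n} A i (divides (suc zero) eq) = IsKGon.notN A i (trans eq (ℕ.+-identityʳ n))
IsKGon-∤ {n = n} A i (divides (suc (suc q)) eq) =
  ℕ.<⇒≱ (IsKGon.below2n A i)
    (subst (2 ℕ.* n ≤_) (sym eq) (ℕ.*-monoˡ-≤ n {2} {2 ℕ.+ q} (ℕ.s≤s (ℕ.s≤s ℕ.z≤n))))

scaled-angleSum-∣ : ∀ {k m} (x : Fin k → ℕ) n → sumℕ x ≡ (k ∸ 2) ℕ.* m →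
  m ℕ.* n ℕ∣.∣ sumℕ (λ i → x i ℕ.* n)
scaled-angleSum-∣ {k} {m} x n Σx = divides (k ∸ 2) (begin
  sumℕ (λ i → x i ℕ.* n)   ≡⟨ sumℕ-*ʳ x n ⟩
  sumℕ x ℕ.* n             ≡⟨ cong (ℕ._* n) Σx ⟩
  (k ∸ 2) ℕ.* m ℕ.* n      ≡⟨ ℕ.*-assoc (k ∸ 2) m n ⟩
  (k ∸ 2) ℕ.* (m ℕ.* n)    ∎)
  where open ≡-Reasoning

record UnitMultiple {k} (n : ℕ) (c a : Fin k → ℕ) : Set where
  field
    unit inverse : ℤ
    inverse*unit≡1 : inverse * unit ≡ + 1 mod n
    c≡unit*a : ∀ i → + c i ≡ unit * + a i mod n

module _ {k n : ℕ} where

  UnitMultiple-sym : ∀ {c a : Fin k → ℕ} → UnitMultiple n c a → UnitMultiple n a c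
  UnitMultiple-sym {c} {a} u = record
    { unit = inverse
    ; inverse = unit
    ; inverse*unit≡1 = subst (_≡ + 1 mod n) (ℤ.*-comm inverse unit) inverse*unit≡1
    ; c≡unit*a = λ i → begin
        + a i                      ≡⟨ ℤ.*-identityˡ (+ a i) ⟨
        + 1 * + a i                ≈⟨ *-congʳ-mod (+ a i) inverse*unit≡1 ⟨
        inverse * unit * + a i     ≡⟨ ℤ.*-assoc inverse unit (+ a i) ⟩
        inverse * (unit * + a i)   ≈⟨ *-congˡ-mod inverse (c≡unit*a i) ⟨
        inverse * + c i            ∎
    }
    where
    open UnitMultiple u
    open ≡mod-Reasoning n

  UnitMultiple-trans : ∀ {c d a : Fin k → ℕ} → UnitMultiple n c d → UnitMultiple n d a → UnitMultiple n c a
  UnitMultiple-trans {c} {d} {a} u v = record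
    { unit = U.unit * V.unit
    ; inverse = V.inverse * U.inverse
    ; inverse*unit≡1 = begin
        V.inverse * U.inverse * (U.unit * V.unit)  ≡⟨ regroup V.inverse U.inverse U.unit V.unit ⟩
        V.inverse * (U.inverse * U.unit * V.unit)  ≈⟨ *-congˡ-mod V.inverse (*-congʳ-mod V.unit U.inverse*unit≡1) ⟩
        V.inverse * (+ 1 * V.unit)                 ≡⟨ cong (V.inverse *_) (ℤ.*-identityˡ V.unit) ⟩
        V.inverse * V.unit                         ≈⟨ V.inverse*unit≡1 ⟩
        + 1                                        ∎
    ; c≡unit*a = λ i → begin
        + c i                      ≈⟨ U.c≡unit*a i ⟩
        U.unit * + d i             ≈⟨ *-congˡ-mod U.unit (V.c≡unit*a i) ⟩
        U.unit * (V.unit * + a i)  ≡⟨ ℤ.*-assoc U.unit V.unit (+ a i) ⟨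
        U.unit * V.unit * + a i    ∎
    }
    where
    module U = UnitMultiple u
    module V = UnitMultiple v
    open ≡mod-Reasoning n
    regroup : ∀ w x y z → w * x * (y * z) ≡ w * (x * y * z)
    regroup = solve-∀

UnitMultiple-weaken : ∀ {k m n} {c a : Fin k → ℕ} → m ℕ∣.∣ n → UnitMultiple n c a → UnitMultiple m c a
UnitMultiple-weaken m∣n u = record
  { unit = unit
  ; inverse = inverse
  ; inverse*unit≡1 = ≡mod-weaken m∣n inverse*unit≡1
  ; c≡unit*a = λ i → ≡mod-weaken m∣n (c≡unit*a i)
  }
  where open UnitMultiple u

UnitMultiple-∣ : ∀ {k n g} {c a : Fin k → ℕ} → UnitMultiple n c a → g ℕ∣.∣ n →
  ∀ i → g ℕ∣.∣ c i → g ℕ∣.∣ a i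
UnitMultiple-∣ {g = g} {c} {a} u g∣n i g∣c =
  ∣⇒∣ᵤ (subst (+ g Signed.∣_) (cancel (+ a i) (unit * + c i)) (Signed.∣m∣n⇒∣m+n g∣a-uc g∣uc))
  where
  open UnitMultiple (UnitMultiple-sym u)
  g∣a-uc : + g Signed.∣ + a i - unit * + c i
  g∣a-uc = divides-difference (≡mod-weaken g∣n (c≡unit*a i))
  g∣uc : + g Signed.∣ unit * + c i
  g∣uc = Signed.∣n⇒∣m*n unit (∣ᵤ⇒∣ g∣c)
  cancel : ∀ x y → x - y + y ≡ x
  cancel = solve-∀

crossSum-UnitMultiple : ∀ {k m n} {d : Fin k → ℕ} (x y : Fin k → ℕ) → Coprime m n →
  (∀ i → d i ≡ x i ℕ.* n ℕ.+ y i ℕ.* m) → UnitMultiple m d x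
crossSum-UnitMultiple {m = m} {n} {d} x y coprime d≡xn+ym = record
  { unit = + n
  ; inverse = proj₁ (coprime⇒invertible coprime)
  ; inverse*unit≡1 = proj₂ (coprime⇒invertible coprime)
  ; c≡unit*a = λ i → begin
      + d i                          ≡⟨ cong +_ (d≡xn+ym i) ⟩
      + (x i ℕ.* n ℕ.+ y i ℕ.* m)    ≡⟨ pos-+* (x i ℕ.* n) (y i) m ⟩
      + (x i ℕ.* n) + + y i * + m    ≈⟨ +-multiple-mod (+ (x i ℕ.* n)) (+ y i) ⟩
      + (x i ℕ.* n)                  ≡⟨ cong +_ (ℕ.*-comm (x i) n) ⟩
      + (n ℕ.* x i)                  ≡⟨ ℤ.pos-* n (x i) ⟩
      + n * + x i                    ∎
  }
  where open ≡mod-Reasoning m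

combination : ∀ {k} → (Fin k → ℕ) → (Fin k → ℤ) → Vecℤ k
combination c x i = sumℤ (λ j → x j * column c j i)

combination-cong : ∀ {k n} (c : Fin k → ℕ) {x z : Fin k → ℤ} → (∀ j → z j ≡ x j mod n) →
  ∀ i → combination c z i ≡ combination c x i mod n
combination-cong c z≡x i = sumℤ-cong-mod (λ j → *-congʳ-mod (column c j i) (z≡x j))

InN-weaken : ∀ {k m n c V} → m ℕ∣.∣ n → InN k n c V → InN k m c V
InN-weaken m∣n (x , cx≈V) = x , λ i → ℕ∣.∣-trans m∣n (cx≈V i)

InN-transfer : ∀ {k n c a V} → UnitMultiple n c a → InN k n c V → InN k n a V
InN-transfer {n = n} {c} {a} {V} u (x , cx≈V) = (λ j → x j * unit) , λ i → ≡mod⇒∣ (begin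
  combination a (λ j → x j * unit) i   ≈⟨ sumℤ-cong-mod (λ j → rescale (idx i j) (x j)) ⟩
  combination c x i                    ≈⟨ ∣⇒≡mod (cx≈V i) ⟩
  V i                                  ∎)
  where
  open UnitMultiple u
  open ≡mod-Reasoning n
  rescale : ∀ l y → y * unit * + a l ≡ y * + c l mod n
  rescale l y = begin
    y * unit * + a l    ≡⟨ ℤ.*-assoc y unit (+ a l) ⟩
    y * (unit * + a l)  ≈⟨ *-congˡ-mod y (c≡unit*a l) ⟨
    y * + c l           ∎

InN-combine : ∀ {k n₁ n₂ c P Q} → Coprime n₁ n₂ → InN k n₁ c P → InN k n₂ c Q →
  Σ (Vecℤ k) λ W → InN k (n₁ ℕ.* n₂) c W × W ≈[ n₁ ] P × W ≈[ n₂ ] Q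
InN-combine {k} {n₁} {n₂} {c} {P} {Q} coprime (x , cx≈P) (y , cy≈Q)
  with crt-idempotent coprime | crt-idempotent (Coprimality.sym coprime)
... | e₁ , e₁≡1 , e₁≡0 | e₂ , e₂≡1 , e₂≡0 =
  W , (z , λ i → ≡mod⇒∣ (≡mod-combine coprime (cz≡W x cz≡cx cx≈P W≡P i) (cz≡W y cz≡cy cy≈Q W≡Q i)))
    , ≡mod⇒∣ ∘ W≡P , ≡mod⇒∣ ∘ W≡Q
  where
  W : Vecℤ k
  W i = e₁ * P i + e₂ * Q i
  z : Fin k → ℤ
  z j = e₁ * x j + e₂ * y j
  W≡P : ∀ i → W i ≡ P i mod n₁
  W≡P i = select₁ (P i) (Q i) e₁≡1 e₂≡0
  W≡Q : ∀ i → W i ≡ Q i mod n₂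
  W≡Q i = select₂ (P i) (Q i) e₁≡0 e₂≡1
  cz≡cx : ∀ i → combination c z i ≡ combination c x i mod n₁
  cz≡cx = combination-cong c (λ j → select₁ (x j) (y j) e₁≡1 e₂≡0)
  cz≡cy : ∀ i → combination c z i ≡ combination c y i mod n₂
  cz≡cy = combination-cong c (λ j → select₂ (x j) (y j) e₁≡0 e₂≡1)
  cz≡W : ∀ {n} x′ {R : Vecℤ k} → (∀ i → combination c z i ≡ combination c x′ i mod n) →
    combination c x′ ≈[ n ] R → (∀ i → W i ≡ R i mod n) → ∀ i → combination c z i ≡ W i mod n
  cz≡W _ cz≡cx′ cx′≈R W≡R i =
    ≡mod-trans (cz≡cx′ i) (≡mod-trans (∣⇒≡mod (cx′≈R i)) (≡mod-sym (W≡R i)))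

module _ {k n₁ n₂ : ℕ} (coprime : Coprime n₁ n₂) {a b c : Fin k → ℕ}
         (ca : UnitMultiple n₁ c a) (cb : UnitMultiple n₂ c b) where

  private
    N = n₁ ℕ.* n₂
    n₁∣N : n₁ ℕ∣.∣ N
    n₁∣N = ℕ∣.m∣m*n n₂
    n₂∣N : n₂ ℕ∣.∣ N
    n₂∣N = ℕ∣.n∣m*n n₁

  IsKGon-of-unitMultiples : IsKGon k n₁ a → IsKGon k n₂ b →
    (∀ i → c i < 2 ℕ.* N) → sumℕ c ≡ (k ∸ 2) ℕ.* N → IsKGon k N c
  IsKGon-of-unitMultiples A B c<2N Σc = record
    { positive = λ i → ℕ.n≢0⇒n>0 (λ c≡0 → n₁∤c i (subst (n₁ ℕ∣.∣_) (sym c≡0) (n₁ ℕ∣.∣0)))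
    ; angleSum = Σc
    ; below2n = c<2N
    ; notN = λ i c≡N → n₁∤c i (subst (n₁ ℕ∣.∣_) (sym c≡N) n₁∣N)
    ; coprime = gcd-trivial
    }
    where
    n₁∤c : ∀ i → ¬ n₁ ℕ∣.∣ c i
    n₁∤c i n₁∣c = IsKGon-∤ A i (UnitMultiple-∣ ca ℕ∣.∣-refl i n₁∣c)
    gcd-trivial : ∀ d → d ℕ∣.∣ N → (∀ i → d ℕ∣.∣ c i) → d ≡ 1
    gcd-trivial d d∣N d∣c = IsKGon.coprime B d d∣n₂ (λ i → UnitMultiple-∣ cb d∣n₂ i (d∣c i))
      where
      g≡1 : gcd d n₁ ≡ 1
      g≡1 = IsKGon.coprime A (gcd d n₁) (gcd[m,n]∣n d n₁)
        (λ i → UnitMultiple-∣ ca (gcd[m,n]∣n d n₁) i (ℕ∣.∣-trans (gcd[m,n]∣m d n₁) (d∣c i)))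
      d∣n₂ : d ℕ∣.∣ n₂
      d∣n₂ = Coprimality.coprime-divisor (Coprimality.gcd≡1⇒coprime g≡1) d∣N

  IsoToProduct-of-unitMultiples : IsoToProduct k N c n₁ a n₂ b
  IsoToProduct-of-unitMultiples = record
    { to₁ = λ (V , V∈N) → V , InN-transfer ca (InN-weaken {c = c} n₁∣N V∈N)
    ; to₂ = λ (V , V∈N) → V , InN-transfer cb (InN-weaken {c = c} n₂∣N V∈N)
    ; cong-to = λ _ _ u≈v → (λ i → ℕ∣.∣-trans n₁∣N (u≈v i)) , (λ i → ℕ∣.∣-trans n₂∣N (u≈v i))
    ; hom₁ = λ u v _ → ≈-refl (proj₁ u ⊕ proj₁ v)
    ; hom₂ = λ u v _ → ≈-refl (proj₁ u ⊕ proj₁ v)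
    ; injective = λ u v → ≈-combine {u = proj₁ u} {proj₁ v} coprime
    ; surjective = λ (P , P∈N₁) (Q , Q∈N₂) →
        let (W , W∈N , W≈P , W≈Q) = InN-combine {c = c} coprime
              (InN-transfer (UnitMultiple-sym ca) P∈N₁) (InN-transfer (UnitMultiple-sym cb) Q∈N₂)
        in (W , W∈N) , W≈P , W≈Q
    }

indicator< : ∀ {k} → ℕ → Fin k → ℕ
indicator< zero    _           = 0
indicator< (suc t) Fin.zero    = 1
indicator< (suc t) (Fin.suc i) = indicator< t i

indicator<≤1 : ∀ {k} t (i : Fin k) → indicator< t i ≤ 1
indicator<≤1 zero    _           = ℕ.z≤n
indicator<≤1 (suc t) Fin.zero    = ℕ.≤-refl
indicator<≤1 (suc t) (Fin.suc i) = indicator<≤1 t i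

sumℕ-indicator< : ∀ {k t} → t ≤ k → sumℕ (indicator< {k} t) ≡ t
sumℕ-indicator< {k} {zero} _ = trans (sumℕ-const k 0) (ℕ.*-zeroʳ k)
sumℕ-indicator< {suc k} {suc t} (ℕ.s≤s t≤k) =
  trans (sumℕ-suc {k} (indicator< (suc t))) (cong suc (sumℕ-indicator< {k} t≤k))

record SignedLift (k N : ℕ) (d : Fin k → ℕ) : Set where
  field
    lift : Fin k → ℕ
    sign : ℤ
    sign*sign≡1 : sign * sign ≡ + 1
    lift≡sign*d : ∀ i → + lift i ≡ sign * + d i mod N
    lift<2N : ∀ i → lift i < 2 ℕ.* N
    sumℕ-lift : sumℕ lift ≡ (k ∸ 2) ℕ.* N

SignedLift⇒UnitMultiple : ∀ {k N d} (L : SignedLift k N d) → UnitMultiple N (SignedLift.lift L) d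
SignedLift⇒UnitMultiple L = record
  { unit = sign
  ; inverse = sign
  ; inverse*unit≡1 = ≡mod-reflexive sign*sign≡1
  ; c≡unit*a = lift≡sign*d
  }
  where open SignedLift L

pad-to-SignedLift : ∀ {k N m} {d : Fin k → ℕ} (e : Fin k → ℕ) ε → ε * ε ≡ + 1 →
  (∀ i → + e i ≡ ε * + d i mod N) → (∀ i → e i < N) → sumℕ e ≡ m ℕ.* N → m ≤ k ∸ 2 →
  SignedLift k N d
pad-to-SignedLift {k} {N} {m} {d} e ε ε*ε≡1 e≡εd e<N Σe≡mN m≤k-2 = record
  { lift = c
  ; sign = ε
  ; sign*sign≡1 = ε*ε≡1
  ; lift≡sign*d = c≡εd
  ; lift<2N = λ i → ℕ.+-mono-<-≤ (e<N i) (ℕ.*-monoˡ-≤ N (indicator<≤1 t i))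
  ; sumℕ-lift = Σc
  }
  where
  t = k ∸ 2 ∸ m
  ind : Fin k → ℕ
  ind = indicator< t
  c : Fin k → ℕ
  c i = e i ℕ.+ ind i ℕ.* N
  c≡εd : ∀ i → + c i ≡ ε * + d i mod N
  c≡εd i = begin
    + c i                  ≡⟨ pos-+* (e i) (ind i) N ⟩
    + e i + + ind i * + N  ≈⟨ +-multiple-mod (+ e i) (+ ind i) ⟩
    + e i                  ≈⟨ e≡εd i ⟩
    ε * + d i              ∎
    where open ≡mod-Reasoning N
  Σc : sumℕ c ≡ (k ∸ 2) ℕ.* N
  Σc = begin
    sumℕ c                                     ≡⟨ sumℕ-+ e (λ i → ind i ℕ.* N) ⟩
    sumℕ e ℕ.+ sumℕ (λ i → ind i ℕ.* N)        ≡⟨ cong₂ ℕ._+_ Σe≡mN (sumℕ-*ʳ ind N) ⟩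
    m ℕ.* N ℕ.+ sumℕ ind ℕ.* N                 ≡⟨ cong (λ s → m ℕ.* N ℕ.+ s ℕ.* N) (sumℕ-indicator< {k} t≤k) ⟩
    m ℕ.* N ℕ.+ t ℕ.* N                        ≡⟨ ℕ.*-distribʳ-+ N m t ⟨
    (m ℕ.+ t) ℕ.* N                            ≡⟨ cong (ℕ._* N) (ℕ.m+[n∸m]≡n m≤k-2) ⟩
    (k ∸ 2) ℕ.* N                              ∎
    where
    open ≡-Reasoning
    t≤k : t ≤ k
    t≤k = ℕ.≤-trans (ℕ.m∸n≤m (k ∸ 2) m) (ℕ.m∸n≤m k 2)

module _ {k N : ℕ} .{{_ : ℕ.NonZero N}} {d : Fin k → ℕ}
         (N∤d : ∀ i → ¬ N ℕ∣.∣ d i) (N∣Σd : N ℕ∣.∣ sumℕ d) where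

  private
    r : Fin k → ℕ
    r i = d i % N

    r≡d : ∀ i → + r i ≡ + d i mod N
    r≡d i = ≡mod-sym (begin
      + d i                      ≡⟨ cong +_ (m≡m%n+[m/n]*n (d i) N) ⟩
      + (r i ℕ.+ d i / N ℕ.* N)  ≡⟨ pos-+* (r i) (d i / N) N ⟩
      + r i + + (d i / N) * + N  ≈⟨ +-multiple-mod (+ r i) (+ (d i / N)) ⟩
      + r i                      ∎)
      where open ≡mod-Reasoning N

    0<r : ∀ i → 0 < r i
    0<r i = ℕ.n≢0⇒n>0 (λ r≡0 → N∤d i (ℕ∣.m%n≡0⇒n∣m (d i) N r≡0))

    r≤N : ∀ i → r i ≤ N
    r≤N i = ℕ.<⇒≤ (m%n<n (d i) N)

    N∣Σr : N ℕ∣.∣ sumℕ r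
    N∣Σr = ℕ∣.∣m+n∣m⇒∣n (subst (N ℕ∣.∣_) Σd≡Σq*N+Σr N∣Σd) (ℕ∣.n∣m*n (sumℕ q))
      where
      q : Fin k → ℕ
      q i = d i / N
      open ≡-Reasoning
      Σd≡Σq*N+Σr : sumℕ d ≡ sumℕ q ℕ.* N ℕ.+ sumℕ r
      Σd≡Σq*N+Σr = begin
        sumℕ d                                   ≡⟨ sumℕ-cong (λ i → m≡m%n+[m/n]*n (d i) N) ⟩
        sumℕ (λ i → r i ℕ.+ q i ℕ.* N)           ≡⟨ sumℕ-+ r (λ i → q i ℕ.* N) ⟩
        sumℕ r ℕ.+ sumℕ (λ i → q i ℕ.* N)        ≡⟨ ℕ.+-comm (sumℕ r) _ ⟩
        sumℕ (λ i → q i ℕ.* N) ℕ.+ sumℕ r        ≡⟨ cong (ℕ._+ sumℕ r) (sumℕ-*ʳ q N) ⟩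
        sumℕ q ℕ.* N ℕ.+ sumℕ r                  ∎

    m : ℕ
    m = ℕ∣.quotient N∣Σr

    Σr≡mN : sumℕ r ≡ m ℕ.* N
    Σr≡mN = ℕ∣._∣_.equality N∣Σr

    N-r≡-d : ∀ i → + (N ∸ r i) ≡ - + 1 * + d i mod N
    N-r≡-d i = begin
      + (N ∸ r i)                ≡⟨ ℤ.⊖-≥ (r≤N i) ⟨
      N ⊖ r i                    ≡⟨ ℤ.[+m]-[+n]≡m⊖n N (r i) ⟨
      + N - + r i                ≡⟨ rearrange (+ N) (+ r i) ⟩
      + 1 * + N + - + 1 * + r i  ≈⟨ +-cong-mod (multiple≡0-mod (+ 1)) (*-congˡ-mod (- + 1) (r≡d i)) ⟩
      + 0 + - + 1 * + d i        ≡⟨ ℤ.+-identityˡ _ ⟩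
      - + 1 * + d i              ∎
      where
      open ≡mod-Reasoning N
      rearrange : ∀ x y → x - y ≡ + 1 * x + - + 1 * y
      rearrange = solve-∀

    Σ[N-r]≡[k-m]N : sumℕ (λ i → N ∸ r i) ≡ (k ∸ m) ℕ.* N
    Σ[N-r]≡[k-m]N = begin
      sumℕ (λ i → N ∸ r i)                      ≡⟨ ℕ.m+n∸n≡m _ (sumℕ r) ⟨
      sumℕ (λ i → N ∸ r i) ℕ.+ sumℕ r ∸ sumℕ r  ≡⟨ cong (_∸ sumℕ r) (sumℕ-+ (λ i → N ∸ r i) r) ⟨
      sumℕ (λ i → N ∸ r i ℕ.+ r i) ∸ sumℕ r     ≡⟨ cong₂ _∸_ (sumℕ-cong (λ i → ℕ.m∸n+n≡m (r≤N i))) Σr≡mN ⟩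
      sumℕ {k} (λ _ → N) ∸ m ℕ.* N              ≡⟨ cong (_∸ m ℕ.* N) (sumℕ-const k N) ⟩
      k ℕ.* N ∸ m ℕ.* N                         ≡⟨ ℕ.*-distribʳ-∸ N k m ⟨
      (k ∸ m) ℕ.* N                             ∎
      where open ≡-Reasoning

  signedLift : 3 ≤ k → SignedLift k N d
  signedLift 3≤k with m ℕ.≤? k ∸ 2
  ... | yes m≤k-2 =
    pad-to-SignedLift r (+ 1) refl (λ i → subst (+ r i ≡_mod N) (sym (ℤ.*-identityˡ (+ d i))) (r≡d i))
      (λ i → m%n<n (d i) N) Σr≡mN m≤k-2
  ... | no m≰k-2 =
    pad-to-SignedLift (λ i → N ∸ r i) (- + 1) refl N-r≡-d
      (λ i → ℕ.∸-monoʳ-< (0<r i) (r≤N i)) Σ[N-r]≡[k-m]N (ℕ.∸-monoʳ-≤ k 2≤m)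
    where
    2≤m : 2 ≤ m
    2≤m = ℕ.≤-trans (ℕ.s≤s (ℕ.∸-monoˡ-≤ 2 3≤k)) (ℕ.≰⇒> m≰k-2)

proposition13 : (k : ℕ) → 3 ≤ k → (n₁ n₂ : ℕ) → 0 < n₁ → 0 < n₂ → gcd n₁ n₂ ≡ 1 →
    (a b : Fin k → ℕ) → IsKGon k n₁ a → IsKGon k n₂ b →
    Σ (Fin k → ℕ) λ c → IsKGon k (n₁ ℕ.* n₂) c × IsoToProduct k (n₁ ℕ.* n₂) c n₁ a n₂ b
proposition13 k 3≤k n₁ n₂ 0<n₁ 0<n₂ gcd≡1 a b A B =
  lift , IsKGon-of-unitMultiples coprime ca cb A B lift<2N sumℕ-lift
       , IsoToProduct-of-unitMultiples coprime ca cb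
  where
  coprime = Coprimality.gcd≡1⇒coprime gcd≡1
  instance
    N≢0 : ℕ.NonZero (n₁ ℕ.* n₂)
    N≢0 = ℕ.>-nonZero (ℕ.*-mono-< 0<n₁ 0<n₂)
  d : Fin k → ℕ
  d i = a i ℕ.* n₂ ℕ.+ b i ℕ.* n₁
  da : UnitMultiple n₁ d a
  da = crossSum-UnitMultiple a b coprime (λ _ → refl)
  db : UnitMultiple n₂ d b
  db = crossSum-UnitMultiple b a (Coprimality.sym coprime) (λ i → ℕ.+-comm (a i ℕ.* n₂) (b i ℕ.* n₁))
  N∤d : ∀ i → ¬ n₁ ℕ.* n₂ ℕ∣.∣ d i
  N∤d i N∣d = IsKGon-∤ A i (UnitMultiple-∣ da ℕ∣.∣-refl i (ℕ∣.∣-trans (ℕ∣.m∣m*n n₂) N∣d))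
  N∣Σd : n₁ ℕ.* n₂ ℕ∣.∣ sumℕ d
  N∣Σd = subst (n₁ ℕ.* n₂ ℕ∣.∣_) (sym (sumℕ-+ (λ i → a i ℕ.* n₂) (λ i → b i ℕ.* n₁)))
    (ℕ∣.∣m∣n⇒∣m+n (scaled-angleSum-∣ a n₂ (IsKGon.angleSum A))
      (subst (ℕ∣._∣ sumℕ (λ i → b i ℕ.* n₁)) (ℕ.*-comm n₂ n₁)
        (scaled-angleSum-∣ b n₁ (IsKGon.angleSum B))))
  L = signedLift N∤d N∣Σd 3≤k
  open SignedLift L
  ca = UnitMultiple-trans (UnitMultiple-weaken (ℕ∣.m∣m*n n₂) (SignedLift⇒UnitMultiple L)) da
  cb = UnitMultiple-trans (UnitMultiple-weaken (ℕ∣.n∣m*n n₁) (SignedLift⇒UnitMultiple L)) db
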